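{- Let $\mathbb{K}$ be a field of characteristic $2$ and let $X^2+a_1X+a_2$ be an irreducible polynomial over $\mathbb{K}$ with $a_1\neq 0$. Let $\alpha$ be a root of it, $\mathbb{L}=\mathbb{K}(\alpha)$, and let $\beta=b_0+b_1\alpha\in\mathbb{L}$ with $b_0,b_1\in\mathbb{K}$. Then $\beta\in T_1T_1$ if and only if the quadratic equation $$X^2+(a_1b_1+1)X+\frac{a_2}{a_1^2}+b_0=0$$ has a solution in $\mathbb{K}$.
   Context: $\mathrm{Tr}=\mathrm{Tr}_{\mathbb{L}/\mathbb{K}}$ is the field trace. $T_1=\{x\in\mathbb{L}\mid\mathrm{Tr}(x)=1\}$ and $T_1T_1=\{xy\mid x,y\in T_1\}$. -}

module Defs where

open import Level using (Level; _⊔_; suc)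
open import Algebra.Bundles using (CommutativeRing)
open import Data.Product using (_×_; _,_; proj₁; proj₂; Σ; ∃)
open import Relation.Nullary using (¬_)

record Field (c ℓ : Level) : Set (suc (c ⊔ ℓ)) where
  field
    commRing : CommutativeRing c ℓ
  open CommutativeRing commRing public
  field
    0≉1   : ¬ (0# ≈ 1#)
    inv   : (x : Carrier) → ¬ (x ≈ 0#) → Carrier
    inv-r : (x : Carrier) (x≉0 : ¬ (x ≈ 0#)) → x * inv x x≉0 ≈ 1#

module _ {c ℓ : Level} (K : Field c ℓ) where
  open Field K

  Char2 : Set ℓ
  Char2 = 1# + 1# ≈ 0#

  -- The monic quadratic X² + a₁X + a₂ is irreducible over K: it does not
  -- factor as a product (X + c)(X + d) of monic linear factors over K
  -- (any factorisation into degree-1 factors can be normalised to monic ones).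
  IrreducibleQuad : Carrier → Carrier → Set (c ⊔ ℓ)
  IrreducibleQuad a₁ a₂ = ¬ (Σ Carrier λ u → Σ Carrier λ v → (u + v ≈ a₁) × (u * v ≈ a₂))

  HasRoot : Carrier → Carrier → Set (c ⊔ ℓ)
  HasRoot p q = Σ Carrier λ x → x * x + p * x + q ≈ 0#

  -- L = K(α) = K[X]/(X² + a₁X + a₂), represented in the K-basis {1, α}:
  -- the pair (x₀ , x₁) stands for x₀ + x₁ α.
  module Ext (a₁ a₂ : Carrier) where
    L : Set c
    L = Carrier × Carrier

    _≈L_ : L → L → Set ℓ
    (x₀ , x₁) ≈L (y₀ , y₁) = (x₀ ≈ y₀) × (x₁ ≈ y₁)

    ι : Carrier → L
    ι x = (x , 0#)

    α : L
    α = (0# , 1#)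

    -- multiplication using α² = -a₁ α - a₂
    _*L_ : L → L → L
    (x₀ , x₁) *L (y₀ , y₁) =
      ( x₀ * y₀ - x₁ * y₁ * a₂
      , x₀ * y₁ + x₁ * y₀ - x₁ * y₁ * a₁ )

    -- Field trace Tr_{L/K}(x): the trace of the K-linear map y ↦ x y
    -- in the basis {1, α}, i.e. (1-coordinate of x·1) + (α-coordinate of x·α).
    Tr : L → Carrier
    Tr x = proj₁ (x *L (1# , 0#)) + proj₂ (x *L α)

    T₁ : L → Set ℓ
    T₁ x = Tr x ≈ 1#

    InT₁T₁ : L → Set (c ⊔ ℓ)
    InT₁T₁ β = Σ L λ x → Σ L λ y → T₁ x × T₁ y × ((x *L y) ≈L β)

-- In characteristic 2 the trace of x₀ + x₁α is a₁x₁, so T₁ is the line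
-- x₀ + a₁⁻¹α. Multiplying out, (u + a₁⁻¹α)(v + a₁⁻¹α) = b₀ + b₁α says exactly
-- u + v = a₁b₁ + 1 and uv = a₂/a₁² + b₀, i.e. that X² + (a₁b₁ + 1)X + a₂/a₁² + b₀
-- factors as (X + u)(X + v); and a monic quadratic with a root in K splits over K.
module Submission where

open import Defs
open import Level using (Level; _⊔_)
open import Algebra.Bundles using (CommutativeRing)
open import Data.Product using (Σ; _×_; _,_; proj₁; proj₂)
open import Relation.Nullary using (¬_)
open import Function.Bundles using (_⇔_; mk⇔; Equivalence)
open import Function.Construct.Composition using (_⇔-∘_)
open import Function.Construct.Symmetry using (⇔-sym)
import Algebra.Solver.Ring.NaturalCoefficients.Default as NaturalSolver
import Relation.Binary.Reasoning.Setoid as SetoidReasoning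

module UnitTranspose {c ℓ : Level} (R : CommutativeRing c ℓ) where
  open CommutativeRing R
  open SetoidReasoning setoid

  unit-transpose : ∀ {a b x y} → a * b ≈ 1# → (b * x ≈ y ⇔ x ≈ a * y)
  unit-transpose {a} {b} {x} {y} ab≈1 = mk⇔ to from
    where
    to : b * x ≈ y → x ≈ a * y
    to bx≈y = begin
      x           ≈⟨ *-identityˡ x ⟨
      1# * x      ≈⟨ *-congʳ ab≈1 ⟨
      a * b * x   ≈⟨ *-assoc a b x ⟩
      a * (b * x) ≈⟨ *-congˡ bx≈y ⟩
      a * y       ∎
    from : x ≈ a * y → b * x ≈ y
    from x≈ay = begin
      b * x       ≈⟨ *-congˡ x≈ay ⟩
      b * (a * y) ≈⟨ *-assoc b a y ⟨
      b * a * y   ≈⟨ *-congʳ (trans (*-comm b a) ab≈1) ⟩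
      1# * y      ≈⟨ *-identityˡ y ⟩
      y           ∎

module CharacteristicTwo {c ℓ : Level} (K : Field c ℓ) (char2 : Char2 K) where
  open Field K
  open NaturalSolver commutativeSemiring
  open SetoidReasoning setoid

  x+x≈0 : ∀ x → x + x ≈ 0#
  x+x≈0 x = begin
    x + x        ≈⟨ solve 1 (λ x → x :+ x := x :* (con 1 :+ con 1)) refl x ⟩
    x * (1# + 1#) ≈⟨ *-congˡ char2 ⟩
    x * 0#        ≈⟨ zeroʳ x ⟩
    0#            ∎

  -x≈x : ∀ x → - x ≈ x
  -x≈x x = begin
    - x           ≈⟨ +-identityʳ (- x) ⟨
    - x + 0#      ≈⟨ +-congˡ (x+x≈0 x) ⟨
    - x + (x + x) ≈⟨ +-assoc (- x) x x ⟨
    - x + x + x   ≈⟨ +-congʳ (-‿inverseˡ x) ⟩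
    0# + x        ≈⟨ +-identityˡ x ⟩
    x             ∎

  x-y≈x+y : ∀ x y → x - y ≈ x + y
  x-y≈x+y x y = +-congˡ (-x≈x y)

  x+z≈y⇒y+z≈x : ∀ {x y z} → x + z ≈ y → y + z ≈ x
  x+z≈y⇒y+z≈x {x} {y} {z} x+z≈y = begin
    y + z       ≈⟨ +-congʳ x+z≈y ⟨
    x + z + z   ≈⟨ +-assoc x z z ⟩
    x + (z + z) ≈⟨ +-congˡ (x+x≈0 z) ⟩
    x + 0#      ≈⟨ +-identityʳ x ⟩
    x           ∎

  +-transpose : ∀ {x y z} → x + z ≈ y ⇔ x ≈ y + z
  +-transpose = mk⇔ (λ x+z≈y → sym (x+z≈y⇒y+z≈x x+z≈y))
                    (λ x≈y+z → x+z≈y⇒y+z≈x (sym x≈y+z))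

module _ {c ℓ : Level} (K : Field c ℓ) where
  open Field K

  -- X² + pX + q = (X + u)(X + v); so IrreducibleQuad K a₁ a₂ is ¬ Splits a₁ a₂.
  Splits : Carrier → Carrier → Set (c ⊔ ℓ)
  Splits p q = Σ Carrier λ u → Σ Carrier λ v → (u + v ≈ p) × (u * v ≈ q)

  module _ (char2 : Char2 K) where
    open CharacteristicTwo K char2
    open NaturalSolver commutativeSemiring
    open SetoidReasoning setoid

    hasRoot⇔splits : ∀ {p q} → HasRoot K p q ⇔ Splits p q
    hasRoot⇔splits {p} {q} = mk⇔ to from
      where
      to : HasRoot K p q → Splits p q
      to (x , root) = x , x + p , sum , product
        where
        sum : x + (x + p) ≈ p
        sum = begin
          x + (x + p) ≈⟨ +-assoc x x p ⟨
          x + x + p   ≈⟨ +-congʳ (x+x≈0 x) ⟩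
          0# + p      ≈⟨ +-identityˡ p ⟩
          p           ∎
        product : x * (x + p) ≈ q
        product = begin
          x * (x + p)     ≈⟨ solve 2 (λ x p → x :* (x :+ p) := x :* x :+ p :* x) refl x p ⟩
          x * x + p * x   ≈⟨ x+z≈y⇒y+z≈x root ⟨
          0# + q          ≈⟨ +-identityˡ q ⟩
          q               ∎
      from : Splits p q → HasRoot K p q
      from (u , v , u+v≈p , uv≈q) = u , (begin
        u * u + p * u + q             ≈⟨ +-cong (+-congˡ (*-congʳ u+v≈p)) uv≈q ⟨
        u * u + (u + v) * u + u * v
          ≈⟨ solve 2 (λ u v → u :* u :+ (u :+ v) :* u :+ u :* v := (u :+ u) :* (u :+ v)) refl u v ⟩
        (u + u) * (u + v)             ≈⟨ *-congʳ (x+x≈0 u) ⟩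
        0# * (u + v)                  ≈⟨ zeroˡ (u + v) ⟩
        0#                            ∎)

module TraceOne {c ℓ : Level} (K : Field c ℓ) (char2 : Char2 K)
  (a₁ a₂ : Field.Carrier K) (a₁≉0 : ¬ (Field._≈_ K a₁ (Field.0# K))) where
  open Field K
  open Ext K a₁ a₂
  open CharacteristicTwo K char2
  open UnitTranspose commRing
  open NaturalSolver commutativeSemiring
  open SetoidReasoning setoid

  a₁⁻¹ : Carrier
  a₁⁻¹ = inv a₁ a₁≉0

  a₁a₁⁻¹≈1 : a₁ * a₁⁻¹ ≈ 1#
  a₁a₁⁻¹≈1 = inv-r a₁ a₁≉0

  Tr≈a₁x₁ : ∀ x₀ x₁ → Tr (x₀ , x₁) ≈ a₁ * x₁
  Tr≈a₁x₁ x₀ x₁ = begin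
    Tr (x₀ , x₁)
      ≈⟨ +-cong (x-y≈x+y _ _) (x-y≈x+y _ _) ⟩
    (x₀ * 1# + x₁ * 0# * a₂) + ((x₀ * 1# + x₁ * 0#) + x₁ * 1# * a₁)
      ≈⟨ solve 4 (λ x₀ x₁ a₁ a₂ →
           (x₀ :* con 1 :+ x₁ :* con 0 :* a₂) :+ ((x₀ :* con 1 :+ x₁ :* con 0) :+ x₁ :* con 1 :* a₁)
           := (x₀ :+ x₀) :+ a₁ :* x₁) refl x₀ x₁ a₁ a₂ ⟩
    (x₀ + x₀) + a₁ * x₁ ≈⟨ +-congʳ (x+x≈0 x₀) ⟩
    0# + a₁ * x₁        ≈⟨ +-identityˡ _ ⟩
    a₁ * x₁             ∎

  T₁⇔ : ∀ {x₀ x₁} → T₁ (x₀ , x₁) ⇔ x₁ ≈ a₁⁻¹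
  T₁⇔ {x₀} {x₁} = mk⇔
    (λ Tr≈1 → trans (Equivalence.to transpose (trans (sym (Tr≈a₁x₁ x₀ x₁)) Tr≈1)) (*-identityʳ a₁⁻¹))
    (λ x₁≈a₁⁻¹ → trans (Tr≈a₁x₁ x₀ x₁) (Equivalence.from transpose (trans x₁≈a₁⁻¹ (sym (*-identityʳ a₁⁻¹)))))
    where
    transpose : a₁ * x₁ ≈ 1# ⇔ x₁ ≈ a₁⁻¹ * 1#
    transpose = unit-transpose (trans (*-comm a₁⁻¹ a₁) a₁a₁⁻¹≈1)

  *L-T₁ : ∀ {x₀ x₁ y₀ y₁} → x₁ ≈ a₁⁻¹ → y₁ ≈ a₁⁻¹ →
          ((x₀ , x₁) *L (y₀ , y₁)) ≈L (x₀ * y₀ + a₂ * (a₁⁻¹ * a₁⁻¹) , a₁⁻¹ * (x₀ + y₀ + 1#))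
  *L-T₁ {x₀} {x₁} {y₀} {y₁} x₁≈a₁⁻¹ y₁≈a₁⁻¹ = coordinate₀ , coordinate₁
    where
    x₁y₁≈a₁⁻¹a₁⁻¹ : x₁ * y₁ ≈ a₁⁻¹ * a₁⁻¹
    x₁y₁≈a₁⁻¹a₁⁻¹ = *-cong x₁≈a₁⁻¹ y₁≈a₁⁻¹
    coordinate₀ : x₀ * y₀ - x₁ * y₁ * a₂ ≈ x₀ * y₀ + a₂ * (a₁⁻¹ * a₁⁻¹)
    coordinate₀ = begin
      x₀ * y₀ - x₁ * y₁ * a₂           ≈⟨ x-y≈x+y _ _ ⟩
      x₀ * y₀ + x₁ * y₁ * a₂           ≈⟨ +-congˡ (*-congʳ x₁y₁≈a₁⁻¹a₁⁻¹) ⟩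
      x₀ * y₀ + a₁⁻¹ * a₁⁻¹ * a₂       ≈⟨ +-congˡ (*-comm _ a₂) ⟩
      x₀ * y₀ + a₂ * (a₁⁻¹ * a₁⁻¹)     ∎
    coordinate₁ : x₀ * y₁ + x₁ * y₀ - x₁ * y₁ * a₁ ≈ a₁⁻¹ * (x₀ + y₀ + 1#)
    coordinate₁ = begin
      x₀ * y₁ + x₁ * y₀ - x₁ * y₁ * a₁
        ≈⟨ x-y≈x+y _ _ ⟩
      x₀ * y₁ + x₁ * y₀ + x₁ * y₁ * a₁
        ≈⟨ +-cong (+-cong (*-congˡ y₁≈a₁⁻¹) (*-congʳ x₁≈a₁⁻¹)) (*-congʳ x₁y₁≈a₁⁻¹a₁⁻¹) ⟩
      x₀ * a₁⁻¹ + a₁⁻¹ * y₀ + a₁⁻¹ * a₁⁻¹ * a₁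
        ≈⟨ solve 4 (λ x₀ y₀ a₁ c →
             x₀ :* c :+ c :* y₀ :+ c :* c :* a₁ := c :* (x₀ :+ y₀ :+ a₁ :* c)) refl x₀ y₀ a₁ a₁⁻¹ ⟩
      a₁⁻¹ * (x₀ + y₀ + a₁ * a₁⁻¹)
        ≈⟨ *-congˡ (+-congˡ a₁a₁⁻¹≈1) ⟩
      a₁⁻¹ * (x₀ + y₀ + 1#) ∎

  T₁-product⇔ : ∀ {x₀ x₁ y₀ y₁ b₀ b₁} → x₁ ≈ a₁⁻¹ → y₁ ≈ a₁⁻¹ →
    ((x₀ , x₁) *L (y₀ , y₁)) ≈L (b₀ , b₁) ⇔
    (x₀ + y₀ ≈ a₁ * b₁ + 1# × x₀ * y₀ ≈ a₂ * (a₁⁻¹ * a₁⁻¹) + b₀)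
  T₁-product⇔ {x₀} {x₁} {y₀} {y₁} {b₀} {b₁} x₁≈a₁⁻¹ y₁≈a₁⁻¹ = mk⇔
    (λ (e₀ , e₁) → sum⇔.to (trans (sym p₁) e₁) , product⇔.to (trans (sym p₀) e₀))
    (λ (sum , product) → trans p₀ (product⇔.from product) , trans p₁ (sum⇔.from sum))
    where
    p₀ : proj₁ ((x₀ , x₁) *L (y₀ , y₁)) ≈ x₀ * y₀ + a₂ * (a₁⁻¹ * a₁⁻¹)
    p₀ = proj₁ (*L-T₁ x₁≈a₁⁻¹ y₁≈a₁⁻¹)
    p₁ : proj₂ ((x₀ , x₁) *L (y₀ , y₁)) ≈ a₁⁻¹ * (x₀ + y₀ + 1#)
    p₁ = proj₂ (*L-T₁ x₁≈a₁⁻¹ y₁≈a₁⁻¹)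
    sum⇔ : a₁⁻¹ * (x₀ + y₀ + 1#) ≈ b₁ ⇔ x₀ + y₀ ≈ a₁ * b₁ + 1#
    sum⇔ = +-transpose ⇔-∘ unit-transpose a₁a₁⁻¹≈1
    module sum⇔ = Equivalence sum⇔
    product⇔ : x₀ * y₀ + a₂ * (a₁⁻¹ * a₁⁻¹) ≈ b₀ ⇔ x₀ * y₀ ≈ a₂ * (a₁⁻¹ * a₁⁻¹) + b₀
    product⇔ = mk⇔ (λ e → trans (Equivalence.to +-transpose e) (+-comm b₀ _))
                   (λ e → Equivalence.from +-transpose (trans e (+-comm _ b₀)))
    module product⇔ = Equivalence product⇔

  InT₁T₁⇔Splits : ∀ {b₀ b₁} → InT₁T₁ (b₀ , b₁) ⇔ Splits K (a₁ * b₁ + 1#) (a₂ * (a₁⁻¹ * a₁⁻¹) + b₀)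
  InT₁T₁⇔Splits = mk⇔
    (λ ((x₀ , x₁) , (y₀ , y₁) , x∈T₁ , y∈T₁ , xy≈b) →
       x₀ , y₀ , Equivalence.to (T₁-product⇔ (Equivalence.to T₁⇔ x∈T₁) (Equivalence.to T₁⇔ y∈T₁)) xy≈b)
    (λ (u , v , uv-equations) →
       (u , a₁⁻¹) , (v , a₁⁻¹) , Equivalence.from T₁⇔ refl , Equivalence.from T₁⇔ refl ,
       Equivalence.from (T₁-product⇔ refl refl) uv-equations)

proposition2p7 : {c ℓ : Level} (K : Field c ℓ) → Char2 K →
    (a₁ a₂ : Field.Carrier K) → IrreducibleQuad K a₁ a₂ →
    (a₁≉0 : ¬ (Field._≈_ K a₁ (Field.0# K))) →
    (b₀ b₁ : Field.Carrier K) →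
    let open Field K
        open Ext K a₁ a₂
        a₁⁻¹ = inv a₁ a₁≉0
    in InT₁T₁ (b₀ , b₁) ⇔ HasRoot K (a₁ * b₁ + 1#) (a₂ * (a₁⁻¹ * a₁⁻¹) + b₀)
proposition2p7 K char2 a₁ a₂ _ a₁≉0 b₀ b₁ =
  ⇔-sym (hasRoot⇔splits K char2) ⇔-∘ InT₁T₁⇔Splits
  where open TraceOne K char2 a₁ a₂ a₁≉0
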